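{- Let $m$ and $n$ be positive integers with $m>n$, $\gcd(m,n)=1$, $m\not\equiv n\pmod 2$, and suppose that $2\,\|\,mn$ (i.e. $2\mid mn$ but $4\nmid mn$). Let $(x,y,z)$ be a positive integer solution of $$(m^2-n^2)^x+(2mn)^y=(m^2+n^2)^z$$ with $y\ge 2$. Then both $x$ and $z$ are even. -}

{-# OPTIONS --safe #-}
module Submission where

-- Since m + n is odd and 4 ∤ mn, one of m, n is ≡ 2 mod 4 and the other is odd. Hence
-- c = m² + n² ≡ 5 and a = m² − n² ≡ 3 or 5 (mod 8), while 8 ∣ (2mn)^y because y ≥ 2,
-- so a^x ≡ c^z (mod 8). Odd squares are ≡ 1 (mod 8), so once x is even, c^z ≡ 1 forces z to
-- be even. If a ≡ 3, an odd x would give a^x ≡ 3, but every power of c is ≡ 1 or 5 (mod 8).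
-- If a ≡ 5, then modulo c we have a ≡ −2n² and 2mn ≡ (m + n)², so an odd x makes 2 a square
-- modulo c. But 2 is a square modulo an odd c only if c ≡ ±1 (mod 8): pick an odd u ≤ c with
-- u² = 2 + kc; then k < c is odd, 2 is a square modulo k, kc ≡ −1 (mod 8), and descend.

open import Data.List using (_∷_; [])
open import Data.Nat
  using (ℕ; zero; suc; _+_; _*_; _∸_; _^_; _≤_; _<_; _%_; _/_; NonZero; >-nonZero; s≤s; z≤n; z<s)
open import Data.Nat.Coprimality using (Coprime; coprime-Bézout; coprime-divisor; gcd≡1⇒coprime)
open import Data.Nat.Divisibility
  using (_∣_; divides; ∣1⇒≡1; ∣m+n∣m⇒∣n; ∣m∣n⇒∣m+n; ∣m⇒∣m*n; ∣n⇒∣m*n; ∣-trans; *-monoʳ-∣)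
open import Data.Nat.DivMod using (m≡m%n+[m/n]*n; [m+kn]%n≡m%n; m%n<n; m<n⇒m%n≡m)
open import Data.Nat.GCD using (gcd; module Bézout)
open import Data.Nat.Induction using (<-rec)
open import Data.Nat.Properties
open import Data.Nat.Tactic.RingSolver using (solve-∀; solve)
open import Data.Product using (_×_; _,_; proj₁; proj₂; ∃-syntax)
open import Data.Sum as Sum using (_⊎_; inj₁; inj₂)
open import Function using (_∘_)
open import Relation.Binary using (IsEquivalence; Setoid)
open import Relation.Binary.PropositionalEquality
open import Relation.Nullary using (¬_; contradiction)

data Odd : ℕ → Set where
  odd : ∀ j → Odd (1 + j * 2)

even-or-odd : ∀ n → 2 ∣ n ⊎ Odd n
even-or-odd zero          = inj₁ (divides 0 refl)
even-or-odd (suc zero)    = inj₂ (odd 0)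
even-or-odd (suc (suc n)) with even-or-odd n
... | inj₁ (divides q eq) = inj₁ (divides (suc q) (cong (2 +_) eq))
... | inj₂ (odd j)        = inj₂ (odd (suc j))

¬even⇒odd : ∀ {n} → ¬ 2 ∣ n → Odd n
¬even⇒odd {n} 2∤n with even-or-odd n
... | inj₁ 2∣n   = contradiction 2∣n 2∤n
... | inj₂ n-odd = n-odd

odd⇒¬even : ∀ {n} → Odd n → ¬ 2 ∣ n
odd⇒¬even (odd j) 2∣n =
  contradiction (∣1⇒≡1 (∣m+n∣m⇒∣n (subst (2 ∣_) (+-comm 1 (j * 2)) 2∣n) (divides j refl))) λ ()

odd-*⇒oddˡ : ∀ {m n} → Odd (m * n) → Odd m
odd-*⇒oddˡ {m} {n} mn-odd = ¬even⇒odd (odd⇒¬even mn-odd ∘ ∣m⇒∣m*n n)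

infix 4 _≡_mod_

-- Witnessing a ≡ b mod d by a + k d = b + l d avoids truncated subtraction and needs no NonZero d.
record _≡_mod_ (a b d : ℕ) : Set where
  constructor mod-eq
  field
    k l : ℕ
    eq  : a + k * d ≡ b + l * d

module _ {d : ℕ} where
  open ≡-Reasoning

  ≡⇒≡mod : ∀ {a b} → a ≡ b → a ≡ b mod d
  ≡⇒≡mod refl = mod-eq 0 0 refl

  ≡mod-sym : ∀ {a b} → a ≡ b mod d → b ≡ a mod d
  ≡mod-sym (mod-eq k l eq) = mod-eq l k (sym eq)

  ≡mod-trans : ∀ {a b c} → a ≡ b mod d → b ≡ c mod d → a ≡ c mod d
  ≡mod-trans {a} {b} {c} (mod-eq k l p) (mod-eq k′ l′ q) = mod-eq (k + k′) (l′ + l) (begin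
    a + (k + k′) * d      ≡⟨ solve (a ∷ k ∷ k′ ∷ d ∷ []) ⟩
    (a + k * d) + k′ * d  ≡⟨ cong (_+ k′ * d) p ⟩
    (b + l * d) + k′ * d  ≡⟨ solve (b ∷ l ∷ k′ ∷ d ∷ []) ⟩
    (b + k′ * d) + l * d  ≡⟨ cong (_+ l * d) q ⟩
    (c + l′ * d) + l * d  ≡⟨ solve (c ∷ l′ ∷ l ∷ d ∷ []) ⟩
    c + (l′ + l) * d      ∎)

  ≡mod-isEquivalence : IsEquivalence (λ a b → a ≡ b mod d)
  ≡mod-isEquivalence = record { refl = ≡⇒≡mod refl ; sym = ≡mod-sym ; trans = ≡mod-trans }

  +-cong-mod : ∀ {a b c e} → a ≡ b mod d → c ≡ e mod d → a + c ≡ b + e mod d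
  +-cong-mod {a} {b} {c} {e} (mod-eq k l p) (mod-eq k′ l′ q) = mod-eq (k + k′) (l + l′) (begin
    a + c + (k + k′) * d        ≡⟨ solve (a ∷ c ∷ k ∷ k′ ∷ d ∷ []) ⟩
    (a + k * d) + (c + k′ * d)  ≡⟨ cong₂ _+_ p q ⟩
    (b + l * d) + (e + l′ * d)  ≡⟨ solve (b ∷ e ∷ l ∷ l′ ∷ d ∷ []) ⟩
    b + e + (l + l′) * d        ∎)

  *-cong-mod : ∀ {a b c e} → a ≡ b mod d → c ≡ e mod d → a * c ≡ b * e mod d
  *-cong-mod {a} {b} {c} {e} (mod-eq k l p) (mod-eq k′ l′ q) =
    mod-eq (a * k′ + k * c + k * k′ * d) (b * l′ + l * e + l * l′ * d) (begin
      a * c + (a * k′ + k * c + k * k′ * d) * d  ≡⟨ solve (a ∷ c ∷ k ∷ k′ ∷ d ∷ []) ⟩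
      (a + k * d) * (c + k′ * d)                 ≡⟨ cong₂ _*_ p q ⟩
      (b + l * d) * (e + l′ * d)                 ≡⟨ solve (b ∷ e ∷ l ∷ l′ ∷ d ∷ []) ⟩
      b * e + (b * l′ + l * e + l * l′ * d) * d  ∎)

  +-congʳ-mod : ∀ {a b} c → a ≡ b mod d → a + c ≡ b + c mod d
  +-congʳ-mod c a≡b = +-cong-mod a≡b (≡⇒≡mod {c} refl)

  *-congˡ-mod : ∀ {a b} c → a ≡ b mod d → c * a ≡ c * b mod d
  *-congˡ-mod c = *-cong-mod (≡⇒≡mod {c} refl)

  *-congʳ-mod : ∀ {a b} c → a ≡ b mod d → a * c ≡ b * c mod d
  *-congʳ-mod c a≡b = *-cong-mod a≡b (≡⇒≡mod {c} refl)

  ^-cong-mod : ∀ {a b} n → a ≡ b mod d → a ^ n ≡ b ^ n mod d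
  ^-cong-mod zero    _   = ≡⇒≡mod refl
  ^-cong-mod (suc n) a≡b = *-cong-mod a≡b (^-cong-mod n a≡b)

  +-cancelˡ-mod : ∀ {a b} c → c + a ≡ c + b mod d → a ≡ b mod d
  +-cancelˡ-mod {a} {b} c (mod-eq k l eq) = mod-eq k l (+-cancelˡ-≡ c _ _ (begin
    c + (a + k * d)  ≡⟨ +-assoc c a (k * d) ⟨
    c + a + k * d    ≡⟨ eq ⟩
    c + b + l * d    ≡⟨ +-assoc c b (l * d) ⟩
    c + (b + l * d)  ∎))

  modulus≡0 : d ≡ 0 mod d
  modulus≡0 = mod-eq 0 1 (solve (d ∷ []))

  *-modulus≡0 : ∀ k → k * d ≡ 0 mod d
  *-modulus≡0 k = mod-eq 0 k (+-identityʳ (k * d))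

  ∣-resp-≡mod : ∀ {e a b} → e ∣ d → a ≡ b mod d → e ∣ a → e ∣ b
  ∣-resp-≡mod {e} {a} {b} e∣d (mod-eq k l eq) e∣a =
    ∣m+n∣m⇒∣n (subst (e ∣_) (trans eq (+-comm b (l * d))) (∣m∣n⇒∣m+n e∣a (∣n⇒∣m*n k e∣d)))
              (∣n⇒∣m*n l e∣d)

  odd-resp-≡mod : ∀ {a b} → 2 ∣ d → a ≡ b mod d → Odd b → Odd a
  odd-resp-≡mod 2∣d a≡b b-odd = ¬even⇒odd (odd⇒¬even b-odd ∘ ∣-resp-≡mod 2∣d a≡b)

  ≡mod⇒%≡ : ∀ {a b} .{{_ : NonZero d}} → a ≡ b mod d → a % d ≡ b % d
  ≡mod⇒%≡ {a} {b} (mod-eq k l eq) = begin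
    a % d            ≡⟨ [m+kn]%n≡m%n a k d ⟨
    (a + k * d) % d  ≡⟨ cong (_% d) eq ⟩
    (b + l * d) % d  ≡⟨ [m+kn]%n≡m%n b l d ⟩
    b % d            ∎

  %≡mod : ∀ a .{{_ : NonZero d}} → a % d ≡ a mod d
  %≡mod a = mod-eq (a / d) 0 (trans (sym (m≡m%n+[m/n]*n a d)) (sym (+-identityʳ a)))

≡mod-setoid : ℕ → Setoid _ _
≡mod-setoid d = record { isEquivalence = ≡mod-isEquivalence {d} }

module ≡mod-Reasoning (d : ℕ) where
  open import Relation.Binary.Reasoning.Setoid (≡mod-setoid d) public

square-cong-mod : ∀ {a b} d → a ≡ b mod (2 * d) → a * a ≡ b * b mod (4 * d)
square-cong-mod {a} {b} d (mod-eq k l eq) = mod-eq (a * k + k * k * d) (b * l + l * l * d) (begin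
  a * a + (a * k + k * k * d) * (4 * d)  ≡⟨ solve (a ∷ k ∷ d ∷ []) ⟩
  (a + k * (2 * d)) * (a + k * (2 * d))  ≡⟨ cong (λ t → t * t) eq ⟩
  (b + l * (2 * d)) * (b + l * (2 * d))  ≡⟨ solve (b ∷ l ∷ d ∷ []) ⟩
  b * b + (b * l + l * l * d) * (4 * d)  ∎)
  where open ≡-Reasoning

+≡0⇒square≡ : ∀ {d} a b → a + b ≡ 0 mod d → a * a ≡ b * b mod d
+≡0⇒square≡ {d} a b a+b≡0 = +-cancelˡ-mod (a * b) (begin
  a * b + a * a  ≡⟨ solve (a ∷ b ∷ []) ⟩
  a * (a + b)    ≈⟨ *-congˡ-mod a a+b≡0 ⟩
  a * 0          ≡⟨ *-zeroʳ a ⟩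
  0              ≡⟨ *-zeroʳ b ⟨
  b * 0          ≈⟨ *-congˡ-mod b a+b≡0 ⟨
  b * (a + b)    ≡⟨ solve (a ∷ b ∷ []) ⟩
  a * b + b * b  ∎)
  where open ≡mod-Reasoning d

odd⇒square≡1[8] : ∀ {u} → Odd u → u * u ≡ 1 mod 8
odd⇒square≡1[8] (odd j) with even-or-odd j
... | inj₁ (divides i refl) = square-cong-mod {b = 1} 2 (mod-eq 0 i (≡1[4] i))
  where
  ≡1[4] : ∀ i → 1 + i * 2 * 2 + 0 * 4 ≡ 1 + i * 4
  ≡1[4] = solve-∀
... | inj₂ (odd i) = ≡mod-trans (square-cong-mod {b = 3} 2 (mod-eq 0 i (≡3[4] i))) (mod-eq 0 1 refl)
  where
  ≡3[4] : ∀ i → 1 + (1 + i * 2) * 2 + 0 * 4 ≡ 3 + i * 4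
  ≡3[4] = solve-∀

^-distribʳ-* : ∀ a b n → (a * b) ^ n ≡ a ^ n * b ^ n
^-distribʳ-* a b zero    = refl
^-distribʳ-* a b (suc n) = begin
  a * b * (a * b) ^ n      ≡⟨ cong (a * b *_) (^-distribʳ-* a b n) ⟩
  a * b * (a ^ n * b ^ n)  ≡⟨ [m*n]*[o*p]≡[m*o]*[n*p] a b (a ^ n) (b ^ n) ⟩
  a * a ^ n * (b * b ^ n)  ∎
  where open ≡-Reasoning

^-even-mod : ∀ {a d n} → a * a ≡ 1 mod d → 2 ∣ n → a ^ n ≡ 1 mod d
^-even-mod {a} {d} a²≡1 (divides q refl) = go q
  where
  open ≡mod-Reasoning d
  go : ∀ q → a ^ (q * 2) ≡ 1 mod d
  go zero    = ≡⇒≡mod refl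
  go (suc q) = begin
    a * (a * a ^ (q * 2))  ≡⟨ *-assoc a a _ ⟨
    a * a * a ^ (q * 2)    ≈⟨ *-cong-mod a²≡1 (go q) ⟩
    1                      ∎

^-odd-mod : ∀ {a d n} → a * a ≡ 1 mod d → Odd n → a ^ n ≡ a mod d
^-odd-mod {a} {d} a²≡1 (odd j) = begin
  a * a ^ (j * 2)  ≈⟨ *-congˡ-mod a (^-even-mod a²≡1 (divides j refl)) ⟩
  a * 1            ≡⟨ *-identityʳ a ⟩
  a                ∎
  where open ≡mod-Reasoning d

+≡0⇒^odd+^odd≡0 : ∀ {d n} a b → a + b ≡ 0 mod d → Odd n → a ^ n + b ^ n ≡ 0 mod d
+≡0⇒^odd+^odd≡0 {d} a b a+b≡0 (odd j) = go j
  where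
  open ≡mod-Reasoning d
  go : ∀ j → a ^ (1 + j * 2) + b ^ (1 + j * 2) ≡ 0 mod d
  go zero    = ≡mod-trans (≡⇒≡mod (cong₂ _+_ (*-identityʳ a) (*-identityʳ b))) a+b≡0
  go (suc j) = begin
    a * (a * A) + b * (b * B)  ≡⟨ cong₂ _+_ (*-assoc a a A) (*-assoc b b B) ⟨
    a * a * A + b * b * B      ≈⟨ +-congʳ-mod (b * b * B) (*-congʳ-mod A (+≡0⇒square≡ a b a+b≡0)) ⟩
    b * b * A + b * b * B      ≡⟨ *-distribˡ-+ (b * b) A B ⟨
    b * b * (A + B)            ≈⟨ *-congˡ-mod (b * b) (go j) ⟩
    b * b * 0                  ≡⟨ *-zeroʳ (b * b) ⟩
    0                          ∎
    where
    A = a ^ (1 + j * 2)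
    B = b ^ (1 + j * 2)

odd-power[8] : ∀ {a} → Odd a → ∀ n → (2 ∣ n × a ^ n ≡ 1 mod 8) ⊎ (Odd n × a ^ n ≡ a mod 8)
odd-power[8] a-odd n = Sum.map (λ 2∣n → 2∣n , ^-even-mod (odd⇒square≡1[8] a-odd) 2∣n)
                               (λ n-odd → n-odd , ^-odd-mod (odd⇒square≡1[8] a-odd) n-odd)
                               (even-or-odd n)

data Invertible (d a : ℕ) : Set where
  inverse : ∀ a′ → a * a′ ≡ 1 mod d → Invertible d a

coprime⇒invertible : ∀ {a d} → Coprime a d → Invertible d a
coprime⇒invertible {a} {d} a⊥d with coprime-Bézout a⊥d
... | Bézout.+- x y 1+yd≡xa =
  inverse x (mod-eq 0 y (trans (+-identityʳ (a * x)) (trans (*-comm a x) (sym 1+yd≡xa))))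
-- Here x a ≡ −1, so (x a)² ≡ 1.
... | Bézout.-+ x y 1+xa≡yd = inverse (x * x * a) (mod-eq (2 * y) (y * y * d) (begin
  a * (x * x * a) + 2 * y * d        ≡⟨ solve (a ∷ x ∷ y ∷ d ∷ []) ⟩
  x * a * (x * a) + 2 * (y * d)      ≡⟨ cong (λ q → x * a * (x * a) + 2 * q) 1+xa≡yd ⟨
  x * a * (x * a) + 2 * (1 + x * a)  ≡⟨ solve (a ∷ x ∷ []) ⟩
  1 + (1 + x * a) * (1 + x * a)      ≡⟨ cong (λ q → 1 + q * q) 1+xa≡yd ⟩
  1 + (y * d) * (y * d)              ≡⟨ solve (y ∷ d ∷ []) ⟩
  1 + y * y * d * d                  ∎))
  where open ≡-Reasoning

invertible-* : ∀ {d a b} → Invertible d a → Invertible d b → Invertible d (a * b)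
invertible-* {d} {a} {b} (inverse a′ aa′≡1) (inverse b′ bb′≡1) = inverse (a′ * b′) (begin
  a * b * (a′ * b′)  ≡⟨ [m*n]*[o*p]≡[m*o]*[n*p] a b a′ b′ ⟩
  a * a′ * (b * b′)  ≈⟨ *-cong-mod aa′≡1 bb′≡1 ⟩
  1                  ∎)
  where open ≡mod-Reasoning d

invertible-^ : ∀ {d a} → Invertible d a → ∀ n → Invertible d (a ^ n)
invertible-^ _     zero    = inverse 1 (≡⇒≡mod refl)
invertible-^ a-inv (suc n) = invertible-* a-inv (invertible-^ a-inv n)

2-invertible : ∀ {d} → Odd d → Invertible d 2
2-invertible (odd j) = inverse (suc j) (mod-eq 0 1 (solve (j ∷ [])))

square≡a*square⇒square≡a : ∀ {d} a t s → t * t ≡ a * (s * s) mod d → Invertible d s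
  → ∃[ r ] r * r ≡ a mod d
square≡a*square⇒square≡a {d} a t s t²≡as² (inverse s′ ss′≡1) = t * s′ , (begin
  t * s′ * (t * s′)          ≡⟨ [m*n]*[o*p]≡[m*o]*[n*p] t s′ t s′ ⟩
  t * t * (s′ * s′)          ≈⟨ *-congʳ-mod (s′ * s′) t²≡as² ⟩
  a * (s * s) * (s′ * s′)    ≡⟨ solve (a ∷ s ∷ s′ ∷ []) ⟩
  a * ((s * s′) * (s * s′))  ≈⟨ *-congˡ-mod a (*-cong-mod ss′≡1 ss′≡1) ⟩
  a * 1                      ≡⟨ *-identityʳ a ⟩
  a                          ∎)
  where open ≡mod-Reasoning d

-- 2 is a square modulo an odd c only if c ≡ ±1 mod 8

odd-square-root : ∀ {c} → Odd c → ∀ t → ∃[ u ] Odd u × u ≤ c × u * u ≡ t * t mod c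
odd-square-root {c} c-odd@(odd _) t with even-or-odd (t % c)
... | inj₂ r-odd = t % c , r-odd , <⇒≤ (m%n<n t c) , *-cong-mod (%≡mod t) (%≡mod t)
... | inj₁ 2∣r   = u , u-odd , m∸n≤m c r , (begin
    u * u  ≈⟨ +≡0⇒square≡ u r (≡mod-trans (≡⇒≡mod u+r≡c) modulus≡0) ⟩
    r * r  ≈⟨ *-cong-mod (%≡mod t) (%≡mod t) ⟩
    t * t  ∎)
  where
  open ≡mod-Reasoning c
  r = t % c
  u = c ∸ r
  u+r≡c : u + r ≡ c
  u+r≡c = m∸n+n≡m (<⇒≤ (m%n<n t c))
  u-odd : Odd u
  u-odd = ¬even⇒odd (λ 2∣u → odd⇒¬even c-odd (subst (2 ∣_) u+r≡c (∣m∣n⇒∣m+n 2∣u 2∣r)))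

square≡2⇒≡2+k*c : ∀ {u c} → 3 ≤ c → u ≤ c → u * u ≡ 2 mod c → ∃[ k ] k < c × u * u ≡ 2 + k * c
square≡2⇒≡2+k*c {u} {c} 3≤c u≤c u²≡2 = k , k<c , u²≡2+kc
  where
  instance
    c-nonZero : NonZero c
    c-nonZero = >-nonZero (<-trans z<s 3≤c)
  k = (u * u) / c
  u²≡2+kc : u * u ≡ 2 + k * c
  u²≡2+kc = trans (m≡m%n+[m/n]*n (u * u) c) (cong (_+ k * c) (trans (≡mod⇒%≡ u²≡2) (m<n⇒m%n≡m 3≤c)))
  k<c : k < c
  k<c = *-cancelʳ-< c k c (begin-strict
    k * c      <⟨ m<n+m (k * c) z<s ⟩
    2 + k * c  ≡⟨ u²≡2+kc ⟨
    u * u      ≤⟨ *-mono-≤ u≤c u≤c ⟩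
    c * c      ∎)
    where open ≤-Reasoning

odd⇒≡1⊎≥3 : ∀ {c} → Odd c → c ≡ 1 ⊎ 3 ≤ c
odd⇒≡1⊎≥3 (odd zero)    = inj₁ refl
odd⇒≡1⊎≥3 (odd (suc _)) = inj₂ (s≤s (s≤s (s≤s z≤n)))

-- For odd c, c * c ≡ 1 mod 16 says c ≡ ±1 mod 8; the squared form is the one that is multiplicative.
two-square-mod⇒square≡1[16] : ∀ c → Odd c → ∀ t → t * t ≡ 2 mod c → c * c ≡ 1 mod 16
two-square-mod⇒square≡1[16] = <-rec _ descent
  where
  descent : ∀ c → (∀ {k} → k < c → Odd k → ∀ t → t * t ≡ 2 mod k → k * k ≡ 1 mod 16)
          → Odd c → ∀ t → t * t ≡ 2 mod c → c * c ≡ 1 mod 16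
  descent c rec c-odd t t²≡2 with odd⇒≡1⊎≥3 c-odd
  ... | inj₁ refl = ≡⇒≡mod refl
  ... | inj₂ 3≤c
    with u , u-odd , u≤c , u²≡t² ← odd-square-root c-odd t
    with k , k<c , u²≡2+kc ← square≡2⇒≡2+k*c 3≤c u≤c (≡mod-trans u²≡t² t²≡2)
    = begin
      c * c              ≡⟨ *-identityˡ (c * c) ⟨
      1 * (c * c)        ≈⟨ *-congʳ-mod (c * c) k²≡1 ⟨
      k * k * (c * c)    ≡⟨ [m*n]*[o*p]≡[m*o]*[n*p] k k c c ⟩
      (k * c) * (k * c)  ≈⟨ [kc]²≡1 ⟩
      1                  ∎
    where
    open ≡mod-Reasoning 16
    kc≡7 : k * c ≡ 7 mod 8
    kc≡7 = +-cancelˡ-mod 2 (≡mod-trans (≡⇒≡mod (sym u²≡2+kc))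
                                       (≡mod-trans (odd⇒square≡1[8] u-odd) (mod-eq 1 0 refl)))
    k-odd : Odd k
    k-odd = odd-*⇒oddˡ (odd-resp-≡mod (divides 4 refl) kc≡7 (odd 3))
    k²≡1 : k * k ≡ 1 mod 16
    k²≡1 = rec k<c k-odd u (mod-eq 0 c (trans (+-identityʳ (u * u)) (trans u²≡2+kc (cong (2 +_) (*-comm k c)))))
    [kc]²≡1 : (k * c) * (k * c) ≡ 1 mod 16
    [kc]²≡1 = ≡mod-trans (square-cong-mod {b = 7} 4 kc≡7) (mod-eq 0 3 refl)

≡5[8]⇒odd : ∀ {c} → c ≡ 5 mod 8 → Odd c
≡5[8]⇒odd c≡5 = odd-resp-≡mod (divides 4 refl) c≡5 (odd 2)

≡5[8]⇒¬two-square : ∀ {c} → c ≡ 5 mod 8 → ¬ (∃[ t ] t * t ≡ 2 mod c)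
≡5[8]⇒¬two-square {c} c≡5 (t , t²≡2) =
  contradiction (≡mod⇒%≡ (≡mod-trans (≡mod-sym c²≡25) c²≡1)) λ ()
  where
  c²≡1 = two-square-mod⇒square≡1[16] c (≡5[8]⇒odd c≡5) t t²≡2
  c²≡25 = square-cong-mod {b = 5} 4 c≡5

2∣∧4∤⇒≡2[4] : ∀ {m} → 2 ∣ m → ¬ 4 ∣ m → m ≡ 2 mod 4
2∣∧4∤⇒≡2[4] (divides q refl) 4∤m with even-or-odd q
... | inj₁ (divides p refl) = contradiction (divides p (*-assoc p 2 2)) 4∤m
... | inj₂ (odd i)          = mod-eq 0 i (≡2+4i i)
  where
  ≡2+4i : ∀ i → (1 + i * 2) * 2 + 0 * 4 ≡ 2 + i * 4
  ≡2+4i = solve-∀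

one-≡2[4]-one-odd : ∀ m n → ¬ 2 ∣ m + n → ¬ 4 ∣ m * n → (m ≡ 2 mod 4 × Odd n) ⊎ (Odd m × n ≡ 2 mod 4)
one-≡2[4]-one-odd m n m+n-odd 4∤mn with even-or-odd m | even-or-odd n
... | inj₁ 2∣m     | inj₁ 2∣n     = contradiction (∣m∣n⇒∣m+n 2∣m 2∣n) m+n-odd
... | inj₁ 2∣m     | inj₂ n-odd   = inj₁ (2∣∧4∤⇒≡2[4] 2∣m (4∤mn ∘ ∣m⇒∣m*n n) , n-odd)
... | inj₂ m-odd   | inj₁ 2∣n     = inj₂ (m-odd , 2∣∧4∤⇒≡2[4] 2∣n (4∤mn ∘ ∣n⇒∣m*n m))
... | inj₂ (odd i) | inj₂ (odd j) = contradiction (divides (1 + i + j) (odd+odd i j)) m+n-odd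
  where
  odd+odd : ∀ i j → 1 + i * 2 + (1 + j * 2) ≡ (1 + i + j) * 2
  odd+odd = solve-∀

difference-of-squares-mod : ∀ {m n s r d} → n ≤ m → n * n ≡ s mod d → m * m ≡ s + r mod d
  → m * m ∸ n * n ≡ r mod d
difference-of-squares-mod {m} {n} {s} {r} {d} n≤m n²≡s m²≡s+r = +-cancelˡ-mod s (begin
  s + (m * m ∸ n * n)      ≡⟨ +-comm s _ ⟩
  (m * m ∸ n * n) + s      ≈⟨ +-cong-mod (≡⇒≡mod {a = m * m ∸ n * n} refl) n²≡s ⟨
  (m * m ∸ n * n) + n * n  ≡⟨ m∸n+n≡m (*-mono-≤ n≤m n≤m) ⟩
  m * m                    ≈⟨ m²≡s+r ⟩
  s + r                    ∎)
  where open ≡mod-Reasoning d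

squares[8] : ∀ m n → n ≤ m → ¬ 2 ∣ m + n → ¬ 4 ∣ m * n
  → m * m + n * n ≡ 5 mod 8 × (m * m ∸ n * n ≡ 3 mod 8 ⊎ m * m ∸ n * n ≡ 5 mod 8)
squares[8] m n n≤m m+n-odd 4∤mn with one-≡2[4]-one-odd m n m+n-odd 4∤mn
... | inj₁ (m≡2 , n-odd) =
  +-cong-mod (square-cong-mod 2 m≡2) (odd⇒square≡1[8] n-odd) ,
  inj₁ (difference-of-squares-mod n≤m (odd⇒square≡1[8] n-odd) (square-cong-mod 2 m≡2))
... | inj₂ (m-odd , n≡2) =
  +-cong-mod (odd⇒square≡1[8] m-odd) (square-cong-mod 2 n≡2) ,
  inj₂ (difference-of-squares-mod n≤m (square-cong-mod 2 n≡2)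
          (≡mod-trans (odd⇒square≡1[8] m-odd) (mod-eq 1 0 refl)))

4∣⇒^≡0[8] : ∀ {b} y → 4 ∣ b → 2 ≤ y → b ^ y ≡ 0 mod 8
4∣⇒^≡0[8] (suc (suc y)) (divides q refl) (s≤s (s≤s _)) =
  ≡mod-trans (≡⇒≡mod (16∣ q ((q * 4) ^ y))) (*-modulus≡0 (2 * q * q * (q * 4) ^ y))
  where
  16∣ : ∀ q B → q * 4 * (q * 4 * B) ≡ 2 * q * q * B * 8
  16∣ = solve-∀

A+B^y≡C⇒A≡C[8] : ∀ A {B C} y → 4 ∣ B → 2 ≤ y → A + B ^ y ≡ C → A ≡ C mod 8
A+B^y≡C⇒A≡C[8] A {B} {C} y 4∣B 2≤y eq = begin
  A          ≡⟨ +-identityʳ A ⟨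
  A + 0      ≈⟨ +-cong-mod (≡⇒≡mod {a = A} refl) (4∣⇒^≡0[8] y 4∣B 2≤y) ⟨
  A + B ^ y  ≡⟨ eq ⟩
  C          ∎
  where open ≡mod-Reasoning 8

even-exponents : ∀ {a c x z} → Odd a → c ≡ 5 mod 8 → a ^ x ≡ c ^ z mod 8 → ¬ Odd x → 2 ∣ x × 2 ∣ z
even-exponents {x = x} {z} a-odd c≡5 a^x≡c^z x-not-odd with odd-power[8] a-odd x
... | inj₂ (x-odd , _)   = contradiction x-odd x-not-odd
... | inj₁ (2∣x , a^x≡1) =
  2∣x , Sum.[ proj₁ , (λ (_ , c^z≡c) → contradiction (≡mod⇒%≡ (1≡5 c^z≡c)) λ ()) ]′
              (odd-power[8] (≡5[8]⇒odd c≡5) z)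
  where
  1≡5 = λ c^z≡c → ≡mod-trans (≡mod-sym a^x≡1) (≡mod-trans a^x≡c^z (≡mod-trans c^z≡c c≡5))

≡3[8]⇒¬odd-exponent : ∀ {a c x} z → a ≡ 3 mod 8 → c ≡ 5 mod 8 → a ^ x ≡ c ^ z mod 8 → ¬ Odd x
≡3[8]⇒¬odd-exponent z a≡3 c≡5 a^x≡c^z x-odd = Sum.[
    (λ (_ , c^z≡1) → contradiction (≡mod⇒%≡ (≡mod-trans 3≡c^z c^z≡1)) λ ()) ,
    (λ (_ , c^z≡c) → contradiction (≡mod⇒%≡ (≡mod-trans 3≡c^z (≡mod-trans c^z≡c c≡5))) λ ()) ]′
  (odd-power[8] (≡5[8]⇒odd c≡5) z)
  where
  a²≡1 = odd⇒square≡1[8] (odd-resp-≡mod (divides 4 refl) a≡3 (odd 1))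
  3≡c^z = ≡mod-trans (≡mod-sym (≡mod-trans (^-odd-mod a²≡1 x-odd) a≡3)) a^x≡c^z

coprime-sum-of-squares : ∀ m n → Coprime m n → Coprime n (m * m + n * n)
coprime-sum-of-squares m n m⊥n {i} (i∣n , i∣c) = m⊥n (coprime-divisor i⊥m i∣m*m , i∣n)
  where
  i∣m*m : i ∣ m * m
  i∣m*m = ∣m+n∣m⇒∣n (subst (i ∣_) (+-comm (m * m) (n * n)) i∣c) (∣m⇒∣m*n n i∣n)
  i⊥m : Coprime i m
  i⊥m (j∣i , j∣m) = m⊥n (j∣m , ∣-trans j∣i i∣n)

odd-exponent⇒two-square : ∀ m n x y z → n ≤ m → Coprime n (m * m + n * n) → Odd (m * m + n * n)
  → Odd x → 1 ≤ z → (m * m ∸ n * n) ^ x + (2 * m * n) ^ y ≡ (m * m + n * n) ^ z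
  → ∃[ t ] t * t ≡ 2 mod (m * m + n * n)
odd-exponent⇒two-square m n x y (suc z) n≤m n⊥c c-odd x-odd@(odd j) _ eq =
  square≡a*square⇒square≡a 2 w N w²≡2N² N-invertible
  where
  a = m * m ∸ n * n
  b = 2 * m * n
  c = m * m + n * n
  D = 2 * (n * n)
  w = (m + n) ^ y
  N = n * D ^ j
  open ≡mod-Reasoning c
  a+D≡c : a + D ≡ c
  a+D≡c = trans (+-double a (n * n)) (cong (_+ n * n) (m∸n+n≡m (*-mono-≤ n≤m n≤m)))
    where
    +-double : ∀ a s → a + 2 * s ≡ a + s + s
    +-double = solve-∀
  b≡[m+n]² : b ≡ (m + n) * (m + n) mod c
  b≡[m+n]² = mod-eq 1 0 (square-of-sum m n)
    where
    square-of-sum : ∀ m n → 2 * m * n + 1 * (m * m + n * n) ≡ (m + n) * (m + n) + 0 * (m * m + n * n)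
    square-of-sum = solve-∀
  b^y≡D^x : b ^ y ≡ D ^ x mod c
  b^y≡D^x = +-cancelˡ-mod (a ^ x) (begin
    a ^ x + b ^ y  ≡⟨ eq ⟩
    c * c ^ z      ≡⟨ *-comm c (c ^ z) ⟩
    c ^ z * c      ≈⟨ *-modulus≡0 (c ^ z) ⟩
    0              ≈⟨ +≡0⇒^odd+^odd≡0 a D (≡mod-trans (≡⇒≡mod a+D≡c) modulus≡0) x-odd ⟨
    a ^ x + D ^ x  ∎)
  w²≡2N² : w * w ≡ 2 * (N * N) mod c
  w²≡2N² = begin
    w * w                    ≡⟨ ^-distribʳ-* (m + n) (m + n) y ⟨
    ((m + n) * (m + n)) ^ y  ≈⟨ ^-cong-mod y b≡[m+n]² ⟨
    b ^ y                    ≈⟨ b^y≡D^x ⟩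
    D * D ^ (j * 2)          ≡⟨ cong (D *_) (^-*-assoc D j 2) ⟨
    D * (D ^ j) ^ 2          ≡⟨ rearrange n (D ^ j) ⟩
    2 * (N * N)              ∎
    where
    rearrange : ∀ n e → 2 * (n * n) * (e * (e * 1)) ≡ 2 * ((n * e) * (n * e))
    rearrange = solve-∀
  N-invertible : Invertible c N
  N-invertible = invertible-* n-invertible (invertible-^ D-invertible j)
    where
    n-invertible = coprime⇒invertible n⊥c
    D-invertible = invertible-* (2-invertible c-odd) (invertible-* n-invertible n-invertible)

lemma2p3 : (m n x y z : ℕ) → 1 ≤ n → n < m → gcd m n ≡ 1 → ¬ (2 ∣ (m + n))
    → 2 ∣ (m * n) → ¬ (4 ∣ (m * n))
    → 1 ≤ x → 1 ≤ z → 2 ≤ y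
    → (m * m ∸ n * n) ^ x + (2 * m * n) ^ y ≡ (m * m + n * n) ^ z
    → (2 ∣ x) × (2 ∣ z)
lemma2p3 m n x y z _ n<m gcd≡1 m+n-odd 2∣mn 4∤mn _ z≥1 y≥2 eq =
  even-exponents a-odd c≡5 a^x≡c^z x-not-odd
  where
  residues = squares[8] m n (<⇒≤ n<m) m+n-odd 4∤mn
  c≡5 = proj₁ residues
  a-odd : Odd (m * m ∸ n * n)
  a-odd = Sum.[ (λ a≡3 → odd-resp-≡mod (divides 4 refl) a≡3 (odd 1)) , ≡5[8]⇒odd ]′ (proj₂ residues)
  4∣b : 4 ∣ 2 * m * n
  4∣b = subst (4 ∣_) (sym (*-assoc 2 m n)) (*-monoʳ-∣ 2 2∣mn)
  a^x≡c^z : (m * m ∸ n * n) ^ x ≡ (m * m + n * n) ^ z mod 8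
  a^x≡c^z = A+B^y≡C⇒A≡C[8] ((m * m ∸ n * n) ^ x) y 4∣b y≥2 eq
  x-not-odd : ¬ Odd x
  x-not-odd x-odd = Sum.[ (λ a≡3 → ≡3[8]⇒¬odd-exponent z a≡3 c≡5 a^x≡c^z x-odd) ,
                          (λ _ → ≡5[8]⇒¬two-square c≡5 two-square) ]′ (proj₂ residues)
    where
    two-square = odd-exponent⇒two-square m n x y z (<⇒≤ n<m) (coprime-sum-of-squares m n (gcd≡1⇒coprime gcd≡1))
                                          (≡5[8]⇒odd c≡5) x-odd z≥1 eq
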